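{- Let $(w_n)_{n\ge0}$ be the sequence over $\mathbb{F}_2$ defined by \[ w_{2n}=1\quad\text{and}\quad w_{2n+1}=w_n+1,\qquad n=0,1,2,\ldots \] Then \[ C_2(w_n,N)>\frac{N}{3}-2\qquad\text{for all } N\ge 6 . \]
   Context: For a binary sequence $(s_n)$ over $\mathbb{F}_2=\{0,1\}$, the $N$th correlation measure of order $2$ is \[ C_2(s_n,N)=\max_{M,d_1,d_2}\left|\sum_{n=0}^{M}(-1)^{s_{n+d_1}+s_{n+d_2}}\right|, \] where the maximum is taken over all integers $M\ge 0$ and $0\le d_1<d_2$ with $d_2+M<N$. -}

module Defs where

open import Data.Bool using (Bool; true; false; not; _xor_; if_then_else_)
open import Data.Nat using (ℕ; zero; suc; _+_; _*_; _∸_; _⊔_; ⌊_/2⌋)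
open import Data.Nat.Properties using ()
open import Data.Integer using (ℤ; +_; -[1+_]; ∣_∣)
import Data.Integer as ℤ
open import Data.List using (List; []; _∷_; map; concatMap; foldr; upTo)
open import Data.Product using (_×_; _,_)

-- Elements of F₂ are represented by Bool (false = 0, true = 1); addition is xor.

-- The sequence w with w_{2n} = 1 and w_{2n+1} = w_n + 1, computed with fuel
-- (fuel n suffices for index n since ⌊n/2⌋ < n for n ≥ 1).
isEven : ℕ → Bool
isEven zero = true
isEven (suc zero) = false
isEven (suc (suc k)) = isEven k

wAux : ℕ → ℕ → Bool
wAux zero n = true  -- fuel exhausted (never reached from w)
wAux (suc fuel) n = if isEven n then true else not (wAux fuel ⌊ n /2⌋)

w : ℕ → Bool
w n = wAux n n

sign : Bool → ℤ
sign false = + 1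
sign true = -[1+ 0 ]

corrSum : (ℕ → Bool) → ℕ → ℕ → ℕ → ℤ
corrSum s M d₁ d₂ = foldr ℤ._+_ (+ 0)
  (map (λ n → sign (s (n + d₁) xor s (n + d₂))) (upTo (suc M)))

triples : ℕ → List (ℕ × ℕ × ℕ)
triples N = concatMap (λ d₂ →
              concatMap (λ d₁ →
                map (λ M → (M , d₁ , d₂)) (upTo (N ∸ d₂)))
              (upTo d₂))
            (upTo N)

-- N-th correlation measure of order 2 (maximum over the finite set of
-- admissible triples; 0 if there are none).
C₂ : (ℕ → Bool) → ℕ → ℕ
C₂ s N = foldr _⊔_ 0 (map (λ { (M , d₁ , d₂) → ∣ corrSum s M d₁ d₂ ∣ }) (triples N))

-- Among the correlations with lag 4, the term (-1)^(w_n + w_{n+4}) equals 1 whenever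
-- n ≢ 3 (mod 4): w vanishes at 4j+1 and is 1 at even places. So every block of four
-- consecutive terms contributes at least 2, the lag-4 sum of length L is at least L/2,
-- and taking M = N - 5 gives C₂(w,N) ≥ (N - 4)/2 > N/3 - 2.
module Submission where

open import Defs
open import Data.Bool using (Bool; true; false; not; _xor_; if_then_else_)
open import Data.Bool.Properties using (xor-same)
open import Data.Nat using (ℕ; zero; suc; _+_; _*_; _∸_; _⊔_; ⌊_/2⌋; _≤_; _<_; z≤n; s≤s; _%_; _/_)
open import Data.Nat.Properties
  using (≤-refl; ≤-trans; <⇒≤; ≤-pred; m≤m*n; ⌊n/2⌋<n; m≤m⊔n; m≤n⊔m; m≤m+n; m+n≤o⇒m≤o; m+n≤o⇒m≤o∸n;
         +-monoʳ-≤; *-assoc; module ≤-Reasoning)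
import Data.Nat.Properties as ℕ
open import Data.Nat.DivMod using (m≡m%n+[m/n]*n; m%n<n)
open import Data.Integer using (ℤ; +_; -[1+_]; ∣_∣; +≤+; -≤-; -≤+) renaming (_+_ to _+ℤ_; _≤_ to _≤ℤ_)
import Data.Integer.Properties as ℤ
open import Data.List using (List; _∷_; map; foldr; upTo; applyUpTo; concatMap)
open import Data.List.Properties using (map-upTo)
open import Data.List.Membership.Propositional using (_∈_)
open import Data.List.Membership.Propositional.Properties using (∈-concatMap⁺; ∈-upTo⁺; ∈-map⁺)
open import Data.List.Relation.Unary.Any using (here; there)
import Data.List.Relation.Unary.Any as Any
open import Data.Product using (_×_; _,_)
open import Data.Nat.Tactic.RingSolver using (solve-∀)
open import Relation.Binary.PropositionalEquality using (_≡_; refl; sym; trans; cong; cong₂; subst; module ≡-Reasoning)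

≤-foldr-⊔ : ∀ {x xs} → x ∈ xs → x ≤ foldr _⊔_ 0 xs
≤-foldr-⊔ {xs = x ∷ xs} (here refl) = m≤m⊔n x _
≤-foldr-⊔ {xs = x ∷ xs} (there x∈xs) = ≤-trans (≤-foldr-⊔ x∈xs) (m≤n⊔m x _)

∈-triples : ∀ {M d₁ d₂ N} → d₁ < d₂ → d₂ + M < N → (M , d₁ , d₂) ∈ triples N
∈-triples {M} {d₁} {d₂} {N} d₁<d₂ d₂+M<N =
  ∈-concatMap⁺ (λ d → concatMap (row d) (upTo d)) (Any.map (λ { refl → d₁-row }) (∈-upTo⁺ (m+n≤o⇒m≤o (suc d₂) d₂+M<N)))
  where
  M<N∸d₂ : M < N ∸ d₂
  M<N∸d₂ = m+n≤o⇒m≤o∸n (suc M) (subst (_≤ N) (cong suc (ℕ.+-comm d₂ M)) d₂+M<N)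
  row : ℕ → ℕ → List (ℕ × ℕ × ℕ)
  row d d′ = map (λ m → (m , d′ , d)) (upTo (N ∸ d))
  d₁-row : (M , d₁ , d₂) ∈ concatMap (row d₂) (upTo d₂)
  d₁-row = ∈-concatMap⁺ (row d₂) (Any.map (λ { refl → ∈-map⁺ _ (∈-upTo⁺ M<N∸d₂) }) (∈-upTo⁺ d₁<d₂))

∣corrSum∣≤C₂ : ∀ s {M d₁ d₂ N} → d₁ < d₂ → d₂ + M < N → ∣ corrSum s M d₁ d₂ ∣ ≤ C₂ s N
∣corrSum∣≤C₂ s d₁<d₂ d₂+M<N = ≤-foldr-⊔ (∈-map⁺ _ (∈-triples d₁<d₂ d₂+M<N))

sumUpTo : (ℕ → ℤ) → ℕ → ℤ
sumUpTo f L = foldr _+ℤ_ (+ 0) (applyUpTo f L)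

sumUpTo-suc : ∀ f L → sumUpTo f (suc L) ≡ sumUpTo f L +ℤ f L
sumUpTo-suc f zero = ℤ.+-comm (f 0) (+ 0)
sumUpTo-suc f (suc L) = trans (cong (f 0 +ℤ_) (sumUpTo-suc (λ n → f (suc n)) L))
                              (sym (ℤ.+-assoc (f 0) _ (f (suc L))))

corrTerm : (ℕ → Bool) → ℕ → ℕ → ℕ → ℤ
corrTerm s d₁ d₂ n = sign (s (n + d₁) xor s (n + d₂))

corrSum≡sumUpTo : ∀ s M d₁ d₂ → corrSum s M d₁ d₂ ≡ sumUpTo (corrTerm s d₁ d₂) (suc M)
corrSum≡sumUpTo s M d₁ d₂ = cong (foldr _+ℤ_ (+ 0)) (map-upTo (corrTerm s d₁ d₂) (suc M))

-1≤sign : ∀ b → -[1+ 0 ] ≤ℤ sign b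
-1≤sign false = -≤+
-1≤sign true = -≤- z≤n

-1≤corrTerm : ∀ s d₁ d₂ n → -[1+ 0 ] ≤ℤ corrTerm s d₁ d₂ n
-1≤corrTerm s d₁ d₂ n = -1≤sign (s (n + d₁) xor s (n + d₂))

module _ {f : ℕ → ℤ} (-1≤f : ∀ n → -[1+ 0 ] ≤ℤ f n) (f≡1 : ∀ j r → r < 3 → f (r + j * 4) ≡ + 1) where

  sumUpTo-partialBlock : ∀ j r → r ≤ 3 → sumUpTo f (r + j * 4) ≡ sumUpTo f (j * 4) +ℤ + r
  sumUpTo-partialBlock j zero _ = sym (ℤ.+-identityʳ _)
  sumUpTo-partialBlock j (suc r) r<3 = begin
    sumUpTo f (suc r + j * 4)                ≡⟨ sumUpTo-suc f (r + j * 4) ⟩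
    sumUpTo f (r + j * 4) +ℤ f (r + j * 4)   ≡⟨ cong₂ _+ℤ_ (sumUpTo-partialBlock j r (<⇒≤ r<3)) (f≡1 j r r<3) ⟩
    sumUpTo f (j * 4) +ℤ + r +ℤ + 1          ≡⟨ ℤ.+-assoc (sumUpTo f (j * 4)) (+ r) (+ 1) ⟩
    sumUpTo f (j * 4) +ℤ + (r + 1)           ≡⟨ cong (λ m → sumUpTo f (j * 4) +ℤ + m) (ℕ.+-comm r 1) ⟩
    sumUpTo f (j * 4) +ℤ + suc r             ∎
    where open ≡-Reasoning

  sumUpTo-blocks : ∀ j → + (j * 2) ≤ℤ sumUpTo f (j * 4)
  sumUpTo-blocks zero = ℤ.≤-refl
  sumUpTo-blocks (suc j) = begin
    + (2 + j * 2)                                  ≡⟨ ℤ.+-comm (+ 2) (+ (j * 2)) ⟩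
    + (j * 2) +ℤ + 2                               ≤⟨ ℤ.+-monoˡ-≤ (+ 2) (sumUpTo-blocks j) ⟩
    sumUpTo f (j * 4) +ℤ + 2                       ≤⟨ ℤ.+-monoʳ-≤ (sumUpTo f (j * 4)) (ℤ.+-monoʳ-≤ (+ 3) (-1≤f (3 + j * 4))) ⟩
    sumUpTo f (j * 4) +ℤ (+ 3 +ℤ f (3 + j * 4))    ≡⟨ ℤ.+-assoc (sumUpTo f (j * 4)) (+ 3) _ ⟨
    sumUpTo f (j * 4) +ℤ + 3 +ℤ f (3 + j * 4)      ≡⟨ cong (_+ℤ f (3 + j * 4)) (sumUpTo-partialBlock j 3 ≤-refl) ⟨
    sumUpTo f (3 + j * 4) +ℤ f (3 + j * 4)         ≡⟨ sumUpTo-suc f (3 + j * 4) ⟨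
    sumUpTo f (4 + j * 4)                          ∎
    where open ℤ.≤-Reasoning

  sumUpTo-lower : ∀ L → + L ≤ℤ sumUpTo f L +ℤ sumUpTo f L
  sumUpTo-lower L = subst (λ n → + n ≤ℤ sumUpTo f n +ℤ sumUpTo f n) (sym (m≡m%n+[m/n]*n L 4))
                          (lower (L / 4) (L % 4) (≤-pred (m%n<n L 4)))
    where
    lower : ∀ j r → r ≤ 3 → + (r + j * 4) ≤ℤ sumUpTo f (r + j * 4) +ℤ sumUpTo f (r + j * 4)
    lower j r r≤3 = begin
      + (r + j * 4)                    ≤⟨ +≤+ (subst (r + j * 4 ≤_) (double j r) (m≤m+n (r + j * 4) r)) ⟩
      + (j * 2 + r) +ℤ + (j * 2 + r)   ≤⟨ ℤ.+-mono-≤ half half ⟩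
      sumUpTo f (r + j * 4) +ℤ sumUpTo f (r + j * 4) ∎
      where
      open ℤ.≤-Reasoning
      double : ∀ j r → (r + j * 4) + r ≡ (j * 2 + r) + (j * 2 + r)
      double = solve-∀
      half : + (j * 2 + r) ≤ℤ sumUpTo f (r + j * 4)
      half = begin
        + (j * 2) +ℤ + r           ≤⟨ ℤ.+-monoˡ-≤ (+ r) (sumUpTo-blocks j) ⟩
        sumUpTo f (j * 4) +ℤ + r   ≡⟨ sumUpTo-partialBlock j r r≤3 ⟨
        sumUpTo f (r + j * 4)      ∎

isEven-double : ∀ m → isEven (m * 2) ≡ true
isEven-double zero = refl
isEven-double (suc m) = isEven-double m

isEven-suc-double : ∀ m → isEven (suc (m * 2)) ≡ false
isEven-suc-double zero = refl
isEven-suc-double (suc m) = isEven-suc-double m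

⌊suc-double/2⌋ : ∀ m → ⌊ suc (m * 2) /2⌋ ≡ m
⌊suc-double/2⌋ zero = refl
⌊suc-double/2⌋ (suc m) = cong suc (⌊suc-double/2⌋ m)

n≤1+f⇒⌊n/2⌋≤f : ∀ {n f} → n ≤ suc f → ⌊ n /2⌋ ≤ f
n≤1+f⇒⌊n/2⌋≤f {zero} _ = z≤n
n≤1+f⇒⌊n/2⌋≤f {suc n} n≤1+f = ≤-pred (≤-trans (⌊n/2⌋<n n) n≤1+f)

wAux-fuel : ∀ {f g} n → n ≤ f → n ≤ g → wAux f n ≡ wAux g n
wAux-fuel {zero} {zero} zero _ _ = refl
wAux-fuel {zero} {suc g} zero _ _ = refl
wAux-fuel {suc f} {zero} zero _ _ = refl
wAux-fuel {suc f} {suc g} n n≤f n≤g =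
  cong (λ b → if isEven n then true else not b) (wAux-fuel ⌊ n /2⌋ (n≤1+f⇒⌊n/2⌋≤f n≤f) (n≤1+f⇒⌊n/2⌋≤f n≤g))

wAux-even : ∀ f m → wAux f (m * 2) ≡ true
wAux-even zero m = refl
wAux-even (suc f) m rewrite isEven-double m = refl

w-even : ∀ m → w (m * 2) ≡ true
w-even m = wAux-even (m * 2) m

w-odd : ∀ m → w (suc (m * 2)) ≡ not (w m)
w-odd m rewrite isEven-suc-double m | ⌊suc-double/2⌋ m = cong not (wAux-fuel m (m≤m*n m 2) ≤-refl)

w-4j : ∀ j → w (j * 4) ≡ true
w-4j j = subst (λ n → w n ≡ true) (*-assoc j 2 2) (w-even (j * 2))

w-4j+1 : ∀ j → w (1 + j * 4) ≡ false
w-4j+1 j = begin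
  w (suc (j * 4))       ≡⟨ cong (λ n → w (suc n)) (*-assoc j 2 2) ⟨
  w (suc (j * 2 * 2))   ≡⟨ w-odd (j * 2) ⟩
  not (w (j * 2))       ≡⟨ cong not (w-even j) ⟩
  false                 ∎
  where open ≡-Reasoning

w-4j+2 : ∀ j → w (2 + j * 4) ≡ true
w-4j+2 j = subst (λ n → w (2 + n) ≡ true) (*-assoc j 2 2) (w-even (suc (j * 2)))

w-shift4 : ∀ j r → r < 3 → w (r + j * 4) ≡ w (r + suc j * 4)
w-shift4 j 0 _ = trans (w-4j j) (sym (w-4j (suc j)))
w-shift4 j 1 _ = trans (w-4j+1 j) (sym (w-4j+1 (suc j)))
w-shift4 j 2 _ = trans (w-4j+2 j) (sym (w-4j+2 (suc j)))
w-shift4 j (suc (suc (suc r))) (s≤s (s≤s (s≤s ())))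

r+j*4+4≡r+[1+j]*4 : ∀ j r → r + j * 4 + 4 ≡ r + suc j * 4
r+j*4+4≡r+[1+j]*4 = solve-∀

corrTerm-w-0-4≡1 : ∀ j r → r < 3 → corrTerm w 0 4 (r + j * 4) ≡ + 1
corrTerm-w-0-4≡1 j r r<3
  rewrite ℕ.+-identityʳ (r + j * 4) | r+j*4+4≡r+[1+j]*4 j r | w-shift4 j r r<3
        | xor-same (w (r + suc j * 4)) = refl

+≤⇒≤∣∣ : ∀ {n i} → + n ≤ℤ i → n ≤ ∣ i ∣
+≤⇒≤∣∣ (+≤+ n≤m) = n≤m

C₂-w-lower : ∀ M → suc M ≤ C₂ w (5 + M) + C₂ w (5 + M)
C₂-w-lower M = begin
  suc M                          ≤⟨ +≤⇒≤∣∣ (sumUpTo-lower (-1≤corrTerm w 0 4) corrTerm-w-0-4≡1 (suc M)) ⟩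
  ∣ S +ℤ S ∣                     ≤⟨ ℤ.∣i+j∣≤∣i∣+∣j∣ S S ⟩
  ∣ S ∣ + ∣ S ∣                  ≤⟨ ℕ.+-mono-≤ ∣S∣≤C₂ ∣S∣≤C₂ ⟩
  C₂ w (5 + M) + C₂ w (5 + M)    ∎
  where
  open ≤-Reasoning
  S : ℤ
  S = sumUpTo (corrTerm w 0 4) (suc M)
  ∣S∣≤C₂ : ∣ S ∣ ≤ C₂ w (5 + M)
  ∣S∣≤C₂ = subst (λ i → ∣ i ∣ ≤ C₂ w (5 + M)) (corrSum≡sumUpTo w M 0 4)
                 (∣corrSum∣≤C₂ w {M} {0} {4} (s≤s z≤n) ≤-refl)

corollary3 : (N : ℕ) → 6 ≤ N → N < 3 * C₂ w N + 6
corollary3 .(5 + suc k) (s≤s (s≤s (s≤s (s≤s (s≤s (s≤s {n = k} z≤n)))))) = begin-strict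
  6 + k          ≡⟨ ℕ.+-comm 6 k ⟩
  k + 6          <⟨ ℕ.+-monoˡ-< 6 k<3C ⟩
  3 * C + 6      ∎
  where
  open ≤-Reasoning
  C : ℕ
  C = C₂ w (5 + suc k)
  k<3C : k < 3 * C
  k<3C = begin-strict
    k              <⟨ ℕ.m<n+m k (s≤s z≤n) ⟩
    2 + k          ≤⟨ C₂-w-lower (suc k) ⟩
    C + C          ≤⟨ +-monoʳ-≤ C (m≤m+n C (C + 0)) ⟩
    3 * C          ∎
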